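{- Let $G$ be a semicomplete digraph and $l,w$ positive integers, and suppose $G$ has an $(l,w)$-spider. Then $G$ has a tame $(l,w')$-spider for some $w'\ge w$.
   Context: Digraphs are simple; $G$ is semicomplete if between every two distinct vertices there is at least one edge. $N^\pm(v)$ are out-/in-neighborhoods, $d^+(v)=|N^+(v)|$; $V^+_{\le d}(G)$ is the set of vertices with $d^+\le d$. ${\rm wld}(v)=|V^+_{\le d^+(v)}(G)\setminus N^+(v)|$. ${\rm pw}(G)$ is the pathwidth, where a path-decomposition is a sequence of bags $(X_1,\dots,X_m)$ covering $V(G)$, with each vertex's bags forming an interval of indices, and for each edge $(u,v)$ some $i\ge j$ with $u\in X_i$, $v\in X_j$; width $\max|X_i|-1$. For integers $d\ge0,l>0,w>0$, a $(d,l,w)$-spider is a triple $(T,L,R)$ with $|T|\ge l$, $L=\{L_v\}_{v\in T}$, $R=\{R_v\}_{v\in T}$ such that for each $v\in T$: $L_v\subseteq N^-(v)$, $|L_v|\ge3l$, $d^+(u)\le d$ for all $u\in L_v$, $R_v\subseteq N^+(v)$, $|R_v|\ge3l$, and $d^+(u)\ge d+w$ for all $u\in R_v$. An $(l,w)$-spider is a $(d,l,w)$-spider for some $d$. For a $(d,l,w)$-spider, a vertex $u\in\bigcup_{v\in T}L_v$ is tame if ${\rm wld}(u)\le 3l+d+w-d^+(u)+2{\rm pw}(G)$, and $u\in\bigcup_{v\in T}R_v$ is tame if ${\rm wld}(u)\le 3l+d^+(u)-d+2{\rm pw}(G)$; $L_v^{\rm tame}$, $R_v^{\rm tame}$ are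 the sets of tame vertices of $L_v$, $R_v$. The $(d,l,w)$-spider is tame if $|L_v^{\rm tame}|\ge2l$ and $|R_v^{\rm tame}|\ge2l$ for all $v\in T$; an $(l,w)$-spider is tame if it is a tame $(d,l,w)$-spider for some $d$. -}

module Defs where

open import Data.Bool using (Bool; true; false; _∧_)
open import Data.Nat using (ℕ; suc; _+_; _*_; _≤_; _≤ᵇ_)
open import Data.Fin using (Fin; toℕ)
open import Data.Fin.Subset using (Subset; _∈_; _⊆_; _∩_; ∁; ∣_∣)
open import Data.Vec using (tabulate)
open import Data.Product using (Σ; ∃; ∃-syntax; _×_)
open import Data.Sum using (_⊎_)
open import Relation.Binary.PropositionalEquality using (_≡_; _≢_)

record Digraph : Set where
  field
    n        : ℕ
    E        : Fin n → Fin n → Bool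
    loopless : ∀ v → E v v ≡ false

module _ (G : Digraph) where
  open Digraph G

  Edge : Fin n → Fin n → Set
  Edge u v = E u v ≡ true

  Semicomplete : Set
  Semicomplete = ∀ u v → u ≢ v → Edge u v ⊎ Edge v u

  N⁺ : Fin n → Subset n
  N⁺ u = tabulate (λ v → E u v)

  N⁻ : Fin n → Subset n
  N⁻ v = tabulate (λ u → E u v)

  d⁺ : Fin n → ℕ
  d⁺ u = ∣ N⁺ u ∣

  V≤ : ℕ → Subset n
  V≤ d = tabulate (λ u → d⁺ u ≤ᵇ d)

  wld : Fin n → ℕ
  wld v = ∣ V≤ (d⁺ v) ∩ ∁ (N⁺ v) ∣

  record PathDecomposition : Set where
    field
      m        : ℕ
      X        : Fin m → Subset n
      covers   : ∀ v → ∃[ i ] v ∈ X i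
      interval : ∀ v (i j k : Fin m) → toℕ i ≤ toℕ j → toℕ j ≤ toℕ k →
                 v ∈ X i → v ∈ X k → v ∈ X j
      edges    : ∀ u v → Edge u v →
                 ∃[ i ] ∃[ j ] (toℕ j ≤ toℕ i × u ∈ X i × v ∈ X j)

  WidthAtMost : PathDecomposition → ℕ → Set
  WidthAtMost D k = ∀ i → ∣ PathDecomposition.X D i ∣ ≤ suc k

  IsPathwidth : ℕ → Set
  IsPathwidth p = (Σ PathDecomposition λ D → WidthAtMost D p)
                × (∀ (D : PathDecomposition) → ∃[ i ] suc p ≤ ∣ PathDecomposition.X D i ∣)

  record Spider (d l w : ℕ) : Set where
    field
      T    : Subset n
      L    : Fin n → Subset n
      R    : Fin n → Subset n
      Tsz  : l ≤ ∣ T ∣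
      L⊆   : ∀ v → v ∈ T → L v ⊆ N⁻ v
      Lsz  : ∀ v → v ∈ T → 3 * l ≤ ∣ L v ∣
      Ldeg : ∀ v → v ∈ T → ∀ u → u ∈ L v → d⁺ u ≤ d
      R⊆   : ∀ v → v ∈ T → R v ⊆ N⁺ v
      Rsz  : ∀ v → v ∈ T → 3 * l ≤ ∣ R v ∣
      Rdeg : ∀ v → v ∈ T → ∀ u → u ∈ R v → d + w ≤ d⁺ u

  -- Tameness w.r.t. pathwidth p.  Since d⁺(u) ≤ d for u ∈ L_v and
  -- d⁺(u) ≥ d + w for u ∈ R_v, the natural-number subtractions of the paper
  -- are moved to the other side:
  --   L: wld(u) ≤ 3l + d + w − d⁺(u) + 2p  ⇔  wld(u) + d⁺(u) ≤ 3l + d + w + 2p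
  --   R: wld(u) ≤ 3l + d⁺(u) − d + 2p      ⇔  wld(u) + d ≤ 3l + d⁺(u) + 2p
  tameLᵇ : (p d l w : ℕ) → Fin n → Bool
  tameLᵇ p d l w u = (wld u + d⁺ u) ≤ᵇ (3 * l + d + w + 2 * p)

  tameRᵇ : (p d l w : ℕ) → Fin n → Bool
  tameRᵇ p d l w u = (wld u + d) ≤ᵇ (3 * l + d⁺ u + 2 * p)

  IsTameSpider : (p d l w : ℕ) → Spider d l w → Set
  IsTameSpider p d l w S =
    ∀ v → v ∈ T →
      (2 * l ≤ ∣ L v ∩ tabulate (tameLᵇ p d l w) ∣) ×
      (2 * l ≤ ∣ R v ∩ tabulate (tameRᵇ p d l w) ∣)
    where open Spider S

  HasSpider : (l w : ℕ) → Set
  HasSpider l w = ∃[ d ] Spider d l w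

  HasTameSpider : (p l w : ℕ) → Set
  HasTameSpider p l w = ∃[ d ] Σ (Spider d l w) (IsTameSpider p d l w)

-- Write W(u) = V⁺_{≤d⁺(u)} ∖ N⁺(u), so wld(u) = |W(u)|.  If a (d,l,w)-spider is not tame,
-- some v ∈ T has at least l untame vertices in L_v or in R_v, and these form the body of a
-- (d,l,w+1)-spider: an untame u gets the left leg W(u) ∖ {u}, resp. W(u) ∩ V⁺_{≤d}, and the
-- right leg N⁺(u) ∖ V⁺_{≤d+w}.  The leg sizes follow from the large wld(u) and two
-- consequences of a path decomposition of width p: |V⁺_{≤c}| ≤ c + p + 1 (take the vertex
-- of V⁺_{≤c} whose first bag is latest; by semicompleteness every other vertex of V⁺_{≤c}
-- lies in that bag or in its out-neighbourhood) and c ≤ |V⁺_{≤c}| + p (dually, take the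
-- vertex of out-degree > c whose last bag is earliest).  As w ≤ n for every (l,w)-spider,
-- iterating ends in a tame spider.
module Submission where

open import Defs
open import Data.Bool using (Bool; true)
open import Data.Bool.Properties using (T-≡)
open import Data.Fin using (Fin; zero; suc; toℕ)
open import Data.Fin.Properties using (any?; all?; ¬∀⟶∃¬)
open import Data.Fin.Subset
  using (Subset; _∈_; _∉_; _⊆_; _∩_; _∪_; ∁; ∣_∣; ⁅_⁆; ⊤; inside; outside; Nonempty; Empty)
open import Data.Fin.Subset.Properties
  using ( _∈?_; nonempty?; Empty-unique; ∣⊥∣≡0; ∣⊤∣≡n; ∣⁅x⁆∣≡1; ∣p∣≤n; p⊆q⇒∣p∣≤∣q∣
        ; x∈p∩q⁺; x∈p∩q⁻; x∈p∪q⁺; x∈∁p⇒x∉p; x∉p⇒x∈∁p; x∉⁅y⁆⇒x≢y)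
open import Data.Nat
open import Data.Nat.Properties
open import Data.Nat.Tactic.RingSolver using (solve-∀)
open import Data.Product using (∃; ∃-syntax; _×_; _,_; proj₁; proj₂)
open import Data.Sum using (_⊎_; inj₁; inj₂)
open import Data.Vec using ([]; _∷_; tabulate)
open import Data.Vec.Properties using (lookup∘tabulate; []=⇒lookup; lookup⇒[]=)
open import Function using (_∘_; Equivalence)
open import Level using (Level)
open import Relation.Binary using (TotalPreorder)
import Relation.Binary.Construct.Flip.EqAndOrd as Flip
open import Relation.Nullary using (¬_; Dec; yes; no; contradiction)
open import Relation.Nullary.Decidable using (_×-dec_; _→-dec_)
open import Relation.Unary using (Pred; Decidable)
open import Relation.Binary.PropositionalEquality

module _ {a ℓ₁ ℓ₂ : Level} (O : TotalPreorder a ℓ₁ ℓ₂) where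
  open TotalPreorder O using (Carrier; _≲_; total) renaming (refl to ≲-refl; trans to ≲-trans)

  argmax : ∀ {n p} (P : Pred (Fin n) p) → Decidable P → (f : Fin n → Carrier) →
           ∀ {x} → P x → ∃ λ y → P y × (∀ z → P z → f z ≲ f y)
  argmax {suc n} P P? f {x} Px with any? (P? ∘ suc)
  ... | no ¬P∘suc = x , Px , λ z Pz → reflexive-at (only-zero x Px) (only-zero z Pz)
    where
    only-zero : ∀ y → P y → y ≡ zero
    only-zero zero    _  = refl
    only-zero (suc y) Py = contradiction (y , Py) ¬P∘suc
    reflexive-at : ∀ {y z} → y ≡ zero → z ≡ zero → f z ≲ f y
    reflexive-at refl refl = ≲-refl
  ... | yes (_ , Py) with argmax (P ∘ suc) (P? ∘ suc) (f ∘ suc) Py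
  ...   | y , Psy , y-max with P? zero
  ...     | no ¬P0 = suc y , Psy , λ { zero P0 → contradiction P0 ¬P0 ; (suc z) Pz → y-max z Pz }
  ...     | yes P0 with total (f zero) (f (suc y))
  ...       | inj₁ 0≲y = suc y , Psy , λ { zero _ → 0≲y ; (suc z) Pz → y-max z Pz }
  ...       | inj₂ y≲0 = zero , P0 , λ { zero _ → ≲-refl ; (suc z) Pz → ≲-trans (y-max z Pz) y≲0 }

argmin : ∀ {a ℓ₁ ℓ₂} (O : TotalPreorder a ℓ₁ ℓ₂) {n p} (P : Pred (Fin n) p) → Decidable P →
         (f : Fin n → TotalPreorder.Carrier O) →
         ∀ {x} → P x → ∃ λ y → P y × (∀ z → P z → TotalPreorder._≲_ O (f y) (f z))
argmin O = argmax (Flip.totalPreorder O)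

private
  variable
    k : ℕ

m+n<o+1+n′⇒m≤o : ∀ {m n n′ o} → n′ ≤ n → m + n < o + suc n′ → m ≤ o
m+n<o+1+n′⇒m≤o {m} {n} {n′} {o} n′≤n m+n<o+1+n′ = +-cancelʳ-≤ n m o (begin
  m + n   ≤⟨ ≤-pred (≤-trans m+n<o+1+n′ (≤-reflexive (+-suc o n′))) ⟩
  o + n′  ≤⟨ +-monoʳ-≤ o n′≤n ⟩
  o + n   ∎)
  where open ≤-Reasoning

∣p∣≡∣p∩q∣+∣p∩∁q∣ : (p q : Subset k) → ∣ p ∣ ≡ ∣ p ∩ q ∣ + ∣ p ∩ ∁ q ∣
∣p∣≡∣p∩q∣+∣p∩∁q∣ []            []            = refl
∣p∣≡∣p∩q∣+∣p∩∁q∣ (inside  ∷ p) (inside  ∷ q) = cong suc (∣p∣≡∣p∩q∣+∣p∩∁q∣ p q)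
∣p∣≡∣p∩q∣+∣p∩∁q∣ (inside  ∷ p) (outside ∷ q) =
  trans (cong suc (∣p∣≡∣p∩q∣+∣p∩∁q∣ p q)) (sym (+-suc _ _))
∣p∣≡∣p∩q∣+∣p∩∁q∣ (outside ∷ p) (inside  ∷ q) = ∣p∣≡∣p∩q∣+∣p∩∁q∣ p q
∣p∣≡∣p∩q∣+∣p∩∁q∣ (outside ∷ p) (outside ∷ q) = ∣p∣≡∣p∩q∣+∣p∩∁q∣ p q

∣p∪q∣≤∣p∣+∣q∣ : (p q : Subset k) → ∣ p ∪ q ∣ ≤ ∣ p ∣ + ∣ q ∣
∣p∪q∣≤∣p∣+∣q∣ []            []            = z≤n
∣p∪q∣≤∣p∣+∣q∣ (inside  ∷ p) (inside  ∷ q) =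
  s≤s (≤-trans (∣p∪q∣≤∣p∣+∣q∣ p q) (≤-trans (n≤1+n _) (≤-reflexive (sym (+-suc _ _)))))
∣p∪q∣≤∣p∣+∣q∣ (inside  ∷ p) (outside ∷ q) = s≤s (∣p∪q∣≤∣p∣+∣q∣ p q)
∣p∪q∣≤∣p∣+∣q∣ (outside ∷ p) (inside  ∷ q) =
  ≤-trans (s≤s (∣p∪q∣≤∣p∣+∣q∣ p q)) (≤-reflexive (sym (+-suc _ _)))
∣p∪q∣≤∣p∣+∣q∣ (outside ∷ p) (outside ∷ q) = ∣p∪q∣≤∣p∣+∣q∣ p q

∣p∣+∣q∣≤∣r∣ : {p q r : Subset k} → p ⊆ r → q ⊆ r → (∀ {x} → x ∈ p → x ∉ q) →
              ∣ p ∣ + ∣ q ∣ ≤ ∣ r ∣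
∣p∣+∣q∣≤∣r∣ {p = p} {q} {r} p⊆r q⊆r disjoint = begin
  ∣ p ∣ + ∣ q ∣             ≤⟨ +-mono-≤ (p⊆q⇒∣p∣≤∣q∣ p⊆r∖q) (p⊆q⇒∣p∣≤∣q∣ q⊆r∩q) ⟩
  ∣ r ∩ ∁ q ∣ + ∣ r ∩ q ∣   ≡⟨ +-comm ∣ r ∩ ∁ q ∣ ∣ r ∩ q ∣ ⟩
  ∣ r ∩ q ∣ + ∣ r ∩ ∁ q ∣   ≡⟨ ∣p∣≡∣p∩q∣+∣p∩∁q∣ r q ⟨
  ∣ r ∣                     ∎
  where
  open ≤-Reasoning
  p⊆r∖q : p ⊆ r ∩ ∁ q
  p⊆r∖q x∈p = x∈p∩q⁺ (p⊆r x∈p , x∉p⇒x∈∁p (disjoint x∈p))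
  q⊆r∩q : q ⊆ r ∩ q
  q⊆r∩q x∈q = x∈p∩q⁺ (q⊆r x∈q , x∈q)

∣p∣≤1+∣p∩∁⁅x⁆∣ : (p : Subset k) (x : Fin k) → ∣ p ∣ ≤ suc ∣ p ∩ ∁ ⁅ x ⁆ ∣
∣p∣≤1+∣p∩∁⁅x⁆∣ p x = begin
  ∣ p ∣                               ≡⟨ ∣p∣≡∣p∩q∣+∣p∩∁q∣ p ⁅ x ⁆ ⟩
  ∣ p ∩ ⁅ x ⁆ ∣ + ∣ p ∩ ∁ ⁅ x ⁆ ∣    ≤⟨ +-monoˡ-≤ _ ∣p∩⁅x⁆∣≤1 ⟩
  suc ∣ p ∩ ∁ ⁅ x ⁆ ∣                 ∎
  where
  open ≤-Reasoning
  ∣p∩⁅x⁆∣≤1 : ∣ p ∩ ⁅ x ⁆ ∣ ≤ 1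
  ∣p∩⁅x⁆∣≤1 = ≤-trans (p⊆q⇒∣p∣≤∣q∣ (proj₂ ∘ x∈p∩q⁻ p _)) (≤-reflexive (∣⁅x⁆∣≡1 x))

l≤∣p∩∁q∣ : ∀ {l} (p q : Subset k) → 3 * l ≤ ∣ p ∣ → ∣ p ∩ q ∣ < 2 * l → l ≤ ∣ p ∩ ∁ q ∣
l≤∣p∩∁q∣ {l = l} p q 3l≤∣p∣ ∣p∩q∣<2l = +-cancelʳ-≤ (2 * l) l ∣ p ∩ ∁ q ∣ (begin
  l + 2 * l                  ≤⟨ 3l≤∣p∣ ⟩
  ∣ p ∣                      ≡⟨ ∣p∣≡∣p∩q∣+∣p∩∁q∣ p q ⟩
  ∣ p ∩ q ∣ + ∣ p ∩ ∁ q ∣    ≤⟨ +-monoˡ-≤ _ (<⇒≤ ∣p∩q∣<2l) ⟩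
  2 * l + ∣ p ∩ ∁ q ∣        ≡⟨ +-comm (2 * l) _ ⟩
  ∣ p ∩ ∁ q ∣ + 2 * l        ∎)
  where open ≤-Reasoning

Empty⇒∣p∣≡0 : {p : Subset k} → Empty p → ∣ p ∣ ≡ 0
Empty⇒∣p∣≡0 {k = k} empty = trans (cong ∣_∣ (Empty-unique empty)) (∣⊥∣≡0 k)

0<∣p∣⇒Nonempty : (p : Subset k) → 0 < ∣ p ∣ → Nonempty p
0<∣p∣⇒Nonempty p 0<∣p∣ with nonempty? p
... | yes nonempty = nonempty
... | no  empty    = contradiction (Empty⇒∣p∣≡0 empty) (>⇒≢ 0<∣p∣)

∈-tabulate⁺ : {f : Fin k → Bool} {x : Fin k} → f x ≡ true → x ∈ tabulate f
∈-tabulate⁺ {f = f} {x} fx = lookup⇒[]= x (tabulate f) (trans (lookup∘tabulate f x) fx)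

∈-tabulate⁻ : {f : Fin k → Bool} {x : Fin k} → x ∈ tabulate f → f x ≡ true
∈-tabulate⁻ {f = f} {x} x∈ = trans (sym (lookup∘tabulate f x)) ([]=⇒lookup x∈)

∈-tabulate-≤ᵇ⁺ : {f g : Fin k → ℕ} {x : Fin k} → f x ≤ g x → x ∈ tabulate (λ y → f y ≤ᵇ g y)
∈-tabulate-≤ᵇ⁺ fx≤gx = ∈-tabulate⁺ (Equivalence.to T-≡ (≤⇒≤ᵇ fx≤gx))

∈-tabulate-≤ᵇ⁻ : {f g : Fin k → ℕ} {x : Fin k} → x ∈ tabulate (λ y → f y ≤ᵇ g y) → f x ≤ g x
∈-tabulate-≤ᵇ⁻ {f = f} {g} {x} x∈ = ≤ᵇ⇒≤ (f x) (g x) (Equivalence.from T-≡ (∈-tabulate⁻ x∈))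

∈∁-tabulate-≤ᵇ⁻ : {f g : Fin k → ℕ} {x : Fin k} → x ∈ ∁ (tabulate (λ y → f y ≤ᵇ g y)) → g x < f x
∈∁-tabulate-≤ᵇ⁻ {f = f} {g} x∈∁ = ≰⇒> (x∈∁p⇒x∉p x∈∁ ∘ ∈-tabulate-≤ᵇ⁺ {f = f} {g})

module _ (G : Digraph) where
  open Digraph G

  ∈V≤⁺ : ∀ {c x} → d⁺ G x ≤ c → x ∈ V≤ G c
  ∈V≤⁺ {c} = ∈-tabulate-≤ᵇ⁺ {f = d⁺ G} {λ _ → c}

  ∈V≤⁻ : ∀ {c x} → x ∈ V≤ G c → d⁺ G x ≤ c
  ∈V≤⁻ {c} = ∈-tabulate-≤ᵇ⁻ {f = d⁺ G} {λ _ → c}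

  ∈∁V≤⁻ : ∀ {c x} → x ∈ ∁ (V≤ G c) → c < d⁺ G x
  ∈∁V≤⁻ {c} = ∈∁-tabulate-≤ᵇ⁻ {f = d⁺ G} {λ _ → c}

  ∈∁V≤-+⁻ : ∀ {d w x} → x ∈ ∁ (V≤ G (d + w)) → d + suc w ≤ d⁺ G x
  ∈∁V≤-+⁻ {d} {w} {x} = subst (_≤ d⁺ G x) (sym (+-suc d w)) ∘ ∈∁V≤⁻

  V≤-mono : ∀ {c c′} → c ≤ c′ → V≤ G c ⊆ V≤ G c′
  V≤-mono c≤c′ x∈V≤c = ∈V≤⁺ (≤-trans (∈V≤⁻ x∈V≤c) c≤c′)

  wldSet : Fin n → Subset n
  wldSet u = V≤ G (d⁺ G u) ∩ ∁ (N⁺ G u)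

  wldSet⊆V≤ : ∀ {u e} → d⁺ G u ≤ e → wldSet u ⊆ V≤ G e
  wldSet⊆V≤ d⁺u≤e x∈W = V≤-mono d⁺u≤e (proj₁ (x∈p∩q⁻ _ _ x∈W))

  wldSet⊆N⁻ : Semicomplete G → ∀ {u x} → x ∈ wldSet u → x ≢ u → x ∈ N⁻ G u
  wldSet⊆N⁻ sc {u} {x} x∈W x≢u with sc u x (x≢u ∘ sym)
  ... | inj₁ u→x = contradiction (∈-tabulate⁺ u→x) (x∈∁p⇒x∉p (proj₂ (x∈p∩q⁻ _ _ x∈W)))
  ... | inj₂ x→u = ∈-tabulate⁺ x→u

module _ (G : Digraph) (D : PathDecomposition G) where
  open Digraph G
  open PathDecomposition D

  IsFirstBag : Fin n → Fin m → Set
  IsFirstBag x i = x ∈ X i × (∀ j → x ∈ X j → toℕ i ≤ toℕ j)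

  IsLastBag : Fin n → Fin m → Set
  IsLastBag x i = x ∈ X i × (∀ j → x ∈ X j → toℕ j ≤ toℕ i)

  firstBag : ∀ x → ∃ (IsFirstBag x)
  firstBag x = argmin ≤-totalPreorder (λ j → x ∈ X j) (λ j → x ∈? X j) toℕ (proj₂ (covers x))

  lastBag : ∀ x → ∃ (IsLastBag x)
  lastBag x = argmax ≤-totalPreorder (λ j → x ∈ X j) (λ j → x ∈? X j) toℕ (proj₂ (covers x))

  first last : Fin n → ℕ
  first = toℕ ∘ proj₁ ∘ firstBag
  last  = toℕ ∘ proj₁ ∘ lastBag

  in-neighbour∈firstBag : ∀ {x y i j} → Edge G y x → IsFirstBag x i →
                          y ∈ X j → toℕ j ≤ toℕ i → y ∈ X i
  in-neighbour∈firstBag {x} {y} {i} {j} y→x (_ , i-first) y∈Xj j≤i with edges y x y→x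
  ... | i′ , j′ , j′≤i′ , y∈Xi′ , x∈Xj′ =
    interval y j i i′ j≤i (≤-trans (i-first j′ x∈Xj′) j′≤i′) y∈Xj y∈Xi′

  out-neighbour∈lastBag : ∀ {x z i j} → Edge G x z → IsLastBag x i →
                          z ∈ X j → toℕ i ≤ toℕ j → z ∈ X i
  out-neighbour∈lastBag {x} {z} {i} {j} x→z (_ , i-last) z∈Xj i≤j with edges x z x→z
  ... | i′ , j′ , j′≤i′ , x∈Xi′ , z∈Xj′ =
    interval z j′ i j (≤-trans j′≤i′ (i-last i′ x∈Xi′)) i≤j z∈Xj′ z∈Xj

  module _ {p : ℕ} (width : WidthAtMost G D p) where

    ∣V≤c∣≤1+c+p : Semicomplete G → ∀ c → ∣ V≤ G c ∣ ≤ suc (c + p)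
    ∣V≤c∣≤1+c+p sc c with nonempty? (V≤ G c)
    ... | no empty = subst (_≤ suc (c + p)) (sym (Empty⇒∣p∣≡0 empty)) z≤n
    ... | yes (x₀ , x₀∈V≤c) with argmax ≤-totalPreorder (_∈ V≤ G c) (_∈? V≤ G c) first x₀∈V≤c
    ...   | x , x∈V≤c , x-latest = begin
      ∣ V≤ G c ∣          ≤⟨ p⊆q⇒∣p∣≤∣q∣ V≤c⊆Xi∪N⁺x ⟩
      ∣ X i ∪ N⁺ G x ∣    ≤⟨ ∣p∪q∣≤∣p∣+∣q∣ (X i) (N⁺ G x) ⟩
      ∣ X i ∣ + d⁺ G x    ≤⟨ +-mono-≤ (width i) (∈V≤⁻ G x∈V≤c) ⟩
      suc p + c           ≡⟨ cong suc (+-comm p c) ⟩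
      suc (c + p)         ∎
      where
      open ≤-Reasoning
      i = proj₁ (firstBag x)
      V≤c⊆Xi∪N⁺x : V≤ G c ⊆ X i ∪ N⁺ G x
      V≤c⊆Xi∪N⁺x {y} y∈V≤c with y ∈? X i
      ... | yes y∈Xi = x∈p∪q⁺ (inj₁ y∈Xi)
      ... | no  y∉Xi with sc x y (λ x≡y → y∉Xi (subst (_∈ X i) x≡y (proj₁ (proj₂ (firstBag x)))))
      ...   | inj₁ x→y = x∈p∪q⁺ (inj₂ (∈-tabulate⁺ x→y))
      ...   | inj₂ y→x = contradiction
        (in-neighbour∈firstBag y→x (proj₂ (firstBag x)) (proj₁ (proj₂ (firstBag y)))
                               (x-latest y y∈V≤c))
        y∉Xi

    c≤∣V≤c∣+p : ∀ c → c ≤ n → c ≤ ∣ V≤ G c ∣ + p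
    c≤∣V≤c∣+p c c≤n with any? (λ y → c <? d⁺ G y)
    ... | no none = begin
      c           ≤⟨ c≤n ⟩
      n           ≡⟨ ∣⊤∣≡n n ⟨
      ∣ ⊤ {n} ∣   ≤⟨ p⊆q⇒∣p∣≤∣q∣ {p = ⊤} (λ {y} _ → ∈V≤⁺ G (≮⇒≥ (λ c<y → none (y , c<y)))) ⟩
      ∣ V≤ G c ∣  ≤⟨ m≤m+n _ p ⟩
      ∣ V≤ G c ∣ + p ∎
      where open ≤-Reasoning
    ... | yes (x₀ , c<x₀)
      with argmin ≤-totalPreorder (λ y → c < d⁺ G y) (λ y → c <? d⁺ G y) last c<x₀
    ...   | x , c<x , x-earliest = ≤-pred (begin
      suc c                  ≤⟨ c<x ⟩
      d⁺ G x                 ≤⟨ p⊆q⇒∣p∣≤∣q∣ N⁺x⊆Xi∪V≤c ⟩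
      ∣ X i ∪ V≤ G c ∣       ≤⟨ ∣p∪q∣≤∣p∣+∣q∣ (X i) (V≤ G c) ⟩
      ∣ X i ∣ + ∣ V≤ G c ∣   ≤⟨ +-monoˡ-≤ _ (width i) ⟩
      suc p + ∣ V≤ G c ∣     ≡⟨ cong suc (+-comm p _) ⟩
      suc (∣ V≤ G c ∣ + p)   ∎)
      where
      open ≤-Reasoning
      i = proj₁ (lastBag x)
      N⁺x⊆Xi∪V≤c : N⁺ G x ⊆ X i ∪ V≤ G c
      N⁺x⊆Xi∪V≤c {z} z∈N⁺x with d⁺ G z ≤? c
      ... | yes z≤c = x∈p∪q⁺ (inj₂ (∈V≤⁺ G z≤c))
      ... | no  z≰c = x∈p∪q⁺ (inj₁
        (out-neighbour∈lastBag (∈-tabulate⁻ z∈N⁺x) (proj₂ (lastBag x))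
                               (proj₁ (proj₂ (lastBag z))) (x-earliest z (≰⇒> z≰c))))

module _ (G : Digraph) (sc : Semicomplete G) {p : ℕ} (D : PathDecomposition G)
         (width : WidthAtMost G D p) where
  open Digraph G

  wld+d⁺≤ : ∀ {u e e′} → d⁺ G u ≤ e → e′ ≤ e →
            wld G u + d⁺ G u ≤ ∣ N⁺ G u ∩ ∁ (V≤ G e′) ∣ + suc (e + p)
  wld+d⁺≤ {u} {e} {e′} d⁺u≤e e′≤e = begin
    wld G u + d⁺ G u              ≡⟨ cong (wld G u +_) (∣p∣≡∣p∩q∣+∣p∩∁q∣ (N⁺ G u) (V≤ G e′)) ⟩
    wld G u + (∣ K′ ∣ + ∣ R ∣)    ≤⟨ +-monoʳ-≤ (wld G u) (+-monoˡ-≤ ∣ R ∣ (p⊆q⇒∣p∣≤∣q∣ K′⊆K)) ⟩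
    wld G u + (∣ K ∣ + ∣ R ∣)     ≡⟨ rearrange (wld G u) (∣ K ∣) (∣ R ∣) ⟩
    ∣ R ∣ + (∣ K ∣ + wld G u)     ≤⟨ +-monoʳ-≤ ∣ R ∣ ∣K∣+wld≤1+e+p ⟩
    ∣ R ∣ + suc (e + p)           ∎
    where
    open ≤-Reasoning
    K′ K R : Subset n
    K′ = N⁺ G u ∩ V≤ G e′
    K  = N⁺ G u ∩ V≤ G e
    R  = N⁺ G u ∩ ∁ (V≤ G e′)
    K′⊆K : K′ ⊆ K
    K′⊆K x∈K′ with x∈p∩q⁻ (N⁺ G u) _ x∈K′
    ... | x∈N⁺ , x∈V≤e′ = x∈p∩q⁺ (x∈N⁺ , V≤-mono G e′≤e x∈V≤e′)
    ∣K∣+wld≤1+e+p : ∣ K ∣ + wld G u ≤ suc (e + p)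
    ∣K∣+wld≤1+e+p = ≤-trans
      (∣p∣+∣q∣≤∣r∣ (proj₂ ∘ x∈p∩q⁻ (N⁺ G u) _) (wldSet⊆V≤ G d⁺u≤e)
                   (λ x∈K x∈W → x∈∁p⇒x∉p (proj₂ (x∈p∩q⁻ _ _ x∈W)) (proj₁ (x∈p∩q⁻ _ _ x∈K))))
      (∣V≤c∣≤1+c+p G D width sc e)
    rearrange : ∀ a b c → a + (b + c) ≡ c + (b + a)
    rearrange = solve-∀

  wld+d≤ : ∀ {u d} → d ≤ d⁺ G u → wld G u + d ≤ ∣ wldSet G u ∩ V≤ G d ∣ + suc (d⁺ G u + 2 * p)
  wld+d≤ {u} {d} d≤d⁺u = begin
    wld G u + d                         ≡⟨ cong (_+ d) (∣p∣≡∣p∩q∣+∣p∩∁q∣ (wldSet G u) (V≤ G d)) ⟩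
    ∣ L ∣ + ∣ W′ ∣ + d                  ≤⟨ +-monoʳ-≤ (∣ L ∣ + ∣ W′ ∣) (c≤∣V≤c∣+p G D width d d≤n) ⟩
    ∣ L ∣ + ∣ W′ ∣ + (∣ V≤ G d ∣ + p)   ≡⟨ rearrange (∣ L ∣) (∣ W′ ∣) (∣ V≤ G d ∣) p ⟩
    ∣ L ∣ + (∣ V≤ G d ∣ + ∣ W′ ∣ + p)   ≤⟨ +-monoʳ-≤ ∣ L ∣ (+-monoˡ-≤ p ∣V≤d∣+∣W′∣≤1+d⁺u+p) ⟩
    ∣ L ∣ + (suc (d⁺ G u + p) + p)      ≡⟨ cong (λ t → ∣ L ∣ + suc t) (a+q+q≡a+2q (d⁺ G u) p) ⟩
    ∣ L ∣ + suc (d⁺ G u + 2 * p)        ∎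
    where
    open ≤-Reasoning
    L W′ : Subset n
    L  = wldSet G u ∩ V≤ G d
    W′ = wldSet G u ∩ ∁ (V≤ G d)
    d≤n : d ≤ n
    d≤n = ≤-trans d≤d⁺u (∣p∣≤n (N⁺ G u))
    ∣V≤d∣+∣W′∣≤1+d⁺u+p : ∣ V≤ G d ∣ + ∣ W′ ∣ ≤ suc (d⁺ G u + p)
    ∣V≤d∣+∣W′∣≤1+d⁺u+p = ≤-trans
      (∣p∣+∣q∣≤∣r∣ (V≤-mono G d≤d⁺u) (wldSet⊆V≤ G ≤-refl ∘ proj₁ ∘ x∈p∩q⁻ _ _)
                   (λ x∈V≤d x∈W′ → x∈∁p⇒x∉p (proj₂ (x∈p∩q⁻ _ _ x∈W′)) x∈V≤d))
      (∣V≤c∣≤1+c+p G D width sc (d⁺ G u))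
    rearrange : ∀ a b c q → a + b + (c + q) ≡ a + (c + b + q)
    rearrange = solve-∀
    a+q+q≡a+2q : ∀ a q → a + q + q ≡ a + 2 * q
    a+q+q≡a+2q = solve-∀

  module _ {l : ℕ} where

    -- The failure of tameLᵇ (for u ∈ L v) and of tameRᵇ (for u ∈ R v), reassociated.
    UntameL UntameR : (d w : ℕ) → Fin n → Set
    UntameL d w u = d⁺ G u ≤ d × 3 * l + (d + w + 2 * p) < wld G u + d⁺ G u
    UntameR d w u = d + w ≤ d⁺ G u × 3 * l + (d⁺ G u + 2 * p) < wld G u + d

    spiderOnUntameL : ∀ {d w} (S : Subset n) → l ≤ ∣ S ∣ → (∀ {u} → u ∈ S → UntameL d w u) →
                      Spider G d l (suc w)
    spiderOnUntameL {d} {w} S l≤∣S∣ untame = record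
      { T    = S
      ; L    = λ u → wldSet G u ∩ ∁ ⁅ u ⁆
      ; R    = λ u → N⁺ G u ∩ ∁ (V≤ G (d + w))
      ; Tsz  = l≤∣S∣
      ; L⊆   = λ u _ x∈L → let x∈W , x∉u = x∈p∩q⁻ _ _ x∈L in
                 wldSet⊆N⁻ G sc x∈W (x∉⁅y⁆⇒x≢y (x∈∁p⇒x∉p x∉u))
      ; Lsz  = λ u u∈S → m+n<o+1+n′⇒m≤o d≤d+w+2p (begin-strict
                 3 * l + (d + w + 2 * p)          <⟨ proj₂ (untame u∈S) ⟩
                 wld G u + d⁺ G u                 ≤⟨ +-mono-≤ (∣p∣≤1+∣p∩∁⁅x⁆∣ (wldSet G u) u)
                                                              (proj₁ (untame u∈S)) ⟩
                 suc ∣ wldSet G u ∩ ∁ ⁅ u ⁆ ∣ + d ≡⟨ +-suc _ d ⟨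
                 ∣ wldSet G u ∩ ∁ ⁅ u ⁆ ∣ + suc d ∎)
      ; Ldeg = λ u u∈S x x∈L → ∈V≤⁻ G (wldSet⊆V≤ G (proj₁ (untame u∈S)) (proj₁ (x∈p∩q⁻ _ _ x∈L)))
      ; R⊆   = λ u _ → proj₁ ∘ x∈p∩q⁻ _ _
      ; Rsz  = λ u u∈S → m+n<o+1+n′⇒m≤o (+-monoʳ-≤ (d + w) (m≤m+n p _)) (begin-strict
                 3 * l + (d + w + 2 * p)          <⟨ proj₂ (untame u∈S) ⟩
                 wld G u + d⁺ G u                 ≤⟨ wld+d⁺≤ (≤-trans (proj₁ (untame u∈S)) d≤d+w) ≤-refl ⟩
                 ∣ N⁺ G u ∩ ∁ (V≤ G (d + w)) ∣ + suc (d + w + p) ∎)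
      ; Rdeg = λ u _ x x∈R → ∈∁V≤-+⁻ G (proj₂ (x∈p∩q⁻ _ _ x∈R))
      }
      where
      open ≤-Reasoning
      d≤d+w : d ≤ d + w
      d≤d+w = m≤m+n d w
      d≤d+w+2p : d ≤ d + w + 2 * p
      d≤d+w+2p = ≤-trans d≤d+w (m≤m+n (d + w) (2 * p))

    spiderOnUntameR : ∀ {d w} → 0 < w → (S : Subset n) → l ≤ ∣ S ∣ →
                      (∀ {u} → u ∈ S → UntameR d w u) → Spider G d l (suc w)
    spiderOnUntameR {d} {w} 0<w S l≤∣S∣ untame = record
      { T    = S
      ; L    = λ u → wldSet G u ∩ V≤ G d
      ; R    = λ u → N⁺ G u ∩ ∁ (V≤ G (d + w))
      ; Tsz  = l≤∣S∣
      ; L⊆   = λ u u∈S x∈L → let x∈W , x∈V≤d = x∈p∩q⁻ _ _ x∈L in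
                 wldSet⊆N⁻ G sc x∈W λ { refl →
                   <⇒≱ (<-≤-trans (m<m+n d 0<w) (proj₁ (untame u∈S))) (∈V≤⁻ G x∈V≤d) }
      ; Lsz  = λ u u∈S → m+n<o+1+n′⇒m≤o ≤-refl (begin-strict
                 3 * l + (d⁺ G u + 2 * p)                <⟨ proj₂ (untame u∈S) ⟩
                 wld G u + d                             ≤⟨ wld+d≤ (d≤d⁺ (untame u∈S)) ⟩
                 ∣ wldSet G u ∩ V≤ G d ∣ + suc (d⁺ G u + 2 * p) ∎)
      ; Ldeg = λ u _ x x∈L → ∈V≤⁻ G (proj₂ (x∈p∩q⁻ _ _ x∈L))
      ; R⊆   = λ u _ → proj₁ ∘ x∈p∩q⁻ _ _
      ; Rsz  = λ u u∈S → m+n<o+1+n′⇒m≤o (+-monoʳ-≤ (d⁺ G u) (m≤m+n p _)) (begin-strict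
                 3 * l + (d⁺ G u + 2 * p)                <⟨ proj₂ (untame u∈S) ⟩
                 wld G u + d                             ≤⟨ +-monoʳ-≤ _ (d≤d⁺ (untame u∈S)) ⟩
                 wld G u + d⁺ G u                        ≤⟨ wld+d⁺≤ ≤-refl (proj₁ (untame u∈S)) ⟩
                 ∣ N⁺ G u ∩ ∁ (V≤ G (d + w)) ∣ + suc (d⁺ G u + p) ∎)
      ; Rdeg = λ u _ x x∈R → ∈∁V≤-+⁻ G (proj₂ (x∈p∩q⁻ _ _ x∈R))
      }
      where
      open ≤-Reasoning
      d≤d⁺ : ∀ {u} → UntameR d w u → d ≤ d⁺ G u
      d≤d⁺ (d+w≤d⁺u , _) = ≤-trans (m≤m+n d w) d+w≤d⁺u

  module _ {d l w : ℕ} (S : Spider G d l w) where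
    open Spider S

    tameL tameR : Subset n
    tameL = tabulate (tameLᵇ G p d l w)
    tameR = tabulate (tameRᵇ G p d l w)

    TameAt : Fin n → Set
    TameAt v = 2 * l ≤ ∣ L v ∩ tameL ∣ × 2 * l ≤ ∣ R v ∩ tameR ∣

    tameAt? : ∀ v → Dec (TameAt v)
    tameAt? v = (2 * l ≤? ∣ L v ∩ tameL ∣) ×-dec (2 * l ≤? ∣ R v ∩ tameR ∣)

    tame? : Dec (IsTameSpider G p d l w S)
    tame? = all? λ v → v ∈? T →-dec tameAt? v

    untameAt : ¬ IsTameSpider G p d l w S →
               ∃ λ v → v ∈ T × (∣ L v ∩ tameL ∣ < 2 * l ⊎ ∣ R v ∩ tameR ∣ < 2 * l)
    untameAt ¬tame with ¬∀⟶∃¬ n _ (λ v → v ∈? T →-dec tameAt? v) ¬tame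
    ... | v , ¬tame-v with v ∈? T | 2 * l ≤? ∣ L v ∩ tameL ∣ | 2 * l ≤? ∣ R v ∩ tameR ∣
    ... | no  v∉T | _       | _       = contradiction (λ v∈T → contradiction v∈T v∉T) ¬tame-v
    ... | yes v∈T | no  ≱2l | _       = v , v∈T , inj₁ (≰⇒> ≱2l)
    ... | yes v∈T | yes _   | no  ≱2l = v , v∈T , inj₂ (≰⇒> ≱2l)
    ... | yes _   | yes ≥2l | yes ≥2l′ = contradiction (λ _ → ≥2l , ≥2l′) ¬tame-v

    untameL : ∀ {v u} → v ∈ T → u ∈ L v ∩ ∁ tameL → UntameL {l} d w u
    untameL {v} {u} v∈T u∈ with x∈p∩q⁻ (L v) _ u∈
    ... | u∈L , u∉tame = Ldeg v v∈T u u∈L , subst (_< wld G u + d⁺ G u) assoc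
      (∈∁-tabulate-≤ᵇ⁻ {f = λ y → wld G y + d⁺ G y} {λ _ → 3 * l + d + w + 2 * p} u∉tame)
      where
      assoc : 3 * l + d + w + 2 * p ≡ 3 * l + (d + w + 2 * p)
      assoc = trans (cong (_+ 2 * p) (+-assoc (3 * l) d w)) (+-assoc (3 * l) (d + w) (2 * p))

    untameR : ∀ {v u} → v ∈ T → u ∈ R v ∩ ∁ tameR → UntameR {l} d w u
    untameR {v} {u} v∈T u∈ with x∈p∩q⁻ (R v) _ u∈
    ... | u∈R , u∉tame = Rdeg v v∈T u u∈R , subst (_< wld G u + d) (+-assoc (3 * l) (d⁺ G u) (2 * p))
      (∈∁-tabulate-≤ᵇ⁻ {f = λ y → wld G y + d} {λ y → 3 * l + d⁺ G y + 2 * p} u∉tame)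

    widen : 0 < w → ¬ IsTameSpider G p d l w S → Spider G d l (suc w)
    widen 0<w ¬tame with untameAt ¬tame
    ... | v , v∈T , inj₁ few =
      spiderOnUntameL (L v ∩ ∁ tameL) (l≤∣p∩∁q∣ (L v) tameL (Lsz v v∈T) few) (untameL v∈T)
    ... | v , v∈T , inj₂ few =
      spiderOnUntameR 0<w (R v ∩ ∁ tameR) (l≤∣p∩∁q∣ (R v) tameR (Rsz v v∈T) few) (untameR v∈T)

    w≤n : 0 < l → w ≤ n
    w≤n 0<l with 0<∣p∣⇒Nonempty T (≤-trans 0<l Tsz)
    ... | v , v∈T with 0<∣p∣⇒Nonempty (R v) (≤-trans 0<l (≤-trans (m≤m+n l (2 * l)) (Rsz v v∈T)))
    ...   | u , u∈R = begin
      w          ≤⟨ m≤n+m w d ⟩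
      d + w      ≤⟨ Rdeg v v∈T u u∈R ⟩
      d⁺ G u     ≤⟨ ∣p∣≤n (N⁺ G u) ⟩
      n          ∎
      where open ≤-Reasoning

  tameSpiderAbove : ∀ fuel {d l w} → 0 < l → 0 < w → n ≤ w + fuel → Spider G d l w →
                    ∃[ w′ ] (w ≤ w′ × HasTameSpider G p l w′)
  tameSpiderAbove fuel {d} {l} {w} 0<l 0<w n≤w+fuel S with tame? S
  ... | yes tame = w , ≤-refl , d , S , tame
  tameSpiderAbove zero    {w = w} 0<l 0<w n≤w+0 S | no ¬tame =
    contradiction (≤-trans n≤w+0 (≤-reflexive (+-identityʳ w))) (<⇒≱ (w≤n (widen S 0<w ¬tame) 0<l))
  tameSpiderAbove (suc fuel) {w = w} 0<l 0<w n≤w+1+fuel S | no ¬tame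
    with tameSpiderAbove fuel 0<l (s≤s z≤n) (subst (n ≤_) (+-suc w fuel) n≤w+1+fuel)
                         (widen S 0<w ¬tame)
  ... | w′ , w+1≤w′ , tameS = w′ , ≤-trans (n≤1+n w) w+1≤w′ , tameS

lemma16 : (G : Digraph) → Semicomplete G → (l w : ℕ) → l > 0 → w > 0 →
    HasSpider G l w → (p : ℕ) → IsPathwidth G p →
    ∃[ w′ ] (w ≤ w′ × HasTameSpider G p l w′)
lemma16 G sc l w 0<l 0<w (d , S) p ((D , width) , _) =
  tameSpiderAbove G sc D width n 0<l 0<w (m≤n+m n w) S
  where open Digraph G
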